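{- Let $k\ge 2$ and $l>\frac{2k^{2}}{\ln k}$ be integers and $U=\{1,\dots,2k+l\}$. A deal is a triple $(A,B,C)$ of pairwise disjoint subsets of $U$ with $|A|=|B|=k$, $|C|=l$, $A\cup B\cup C=U$. Let $\mathcal{A}$ be a nonempty family of $k$-element subsets of $U$ with $\bigcup_{A\in\mathcal{A}}A=U$ and $\bigcap_{A\in\mathcal{A}}A=\emptyset$. Then there exist two distinct deals $s_1=(A_1,B_1,C_1)$ and $s_2=(A_2,B_2,C_2)$ with $A_1,A_2\in\mathcal{A}$ and $B_1=B_2$ (i.e. $s_1\neq s_2$ are indistinguishable for Bill, whose knowledge initially consists only of his own hand).
   Context: $\mathcal{A}$ represents the set of Anne's hands for which Anne makes a given public announcement $\alpha$ in the generalized Russian Cards Problem RCP$(k;l)$, where Anne and Bill hold $k$ cards each and Cath holds $l$ cards. In the initial Kripke model two deals are indistinguishable for Bill iff Bill's hands in them are equal. -}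

module Defs where

open import Data.Nat as ℕ using (ℕ; zero; suc; _+_; _*_; _^_; _!)
open import Data.Nat.Properties using (_!≢0)
open import Data.Integer using (+_)
open import Data.Rational as ℚ using (ℚ; 0ℚ; _/_)
open import Data.Fin using (Fin)
open import Data.Fin.Subset using (Subset; _∩_; _∪_; ∣_∣; _∈_; _∉_) renaming (⊥ to ∅; ⊤ to Full)
open import Data.Product using (Σ; _×_; ∃)
open import Relation.Binary.PropositionalEquality using (_≡_)

-- For k ≥ 2 we have ln k > 0, so  l > 2k²/ln k  ⇔  l·ln k > 2k²
-- ⇔  ln (k^l) > 2k²  ⇔  e^(2k²) < k^l.
-- e^m is the supremum of the increasing partial sums
--   expPartial m N = Σ_{n < N} m^n / n!
-- so  e^m < x  iff some rational ε > 0 has  expPartial m N + ε ≤ x  for all N.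

expTerm : ℕ → ℕ → ℚ
expTerm m n = (+ (m ^ n)) / (n !)
  where instance _ = n !≢0

expPartial : ℕ → ℕ → ℚ
expPartial m zero    = 0ℚ
expPartial m (suc N) = expPartial m N ℚ.+ expTerm m N

ExpBelow : ℕ → ℕ → Set
ExpBelow m x = Σ ℚ λ ε → (0ℚ ℚ.< ε) × (∀ N → expPartial m N ℚ.+ ε ℚ.≤ ((+ x) / 1))

-- LogBound k l  :⇔  l > 2k²/ln k   (meaningful for k ≥ 2, where ln k > 0)
LogBound : ℕ → ℕ → Set
LogBound k l = ExpBelow (2 * (k * k)) (k ^ l)

-- Cards: U = {1,…,2k+l} represented as Fin (k + k + l); hands are subsets.

record IsDeal (k l : ℕ) (A B C : Subset (k + k + l)) : Set where
  field
    disjAB : A ∩ B ≡ ∅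
    disjAC : A ∩ C ≡ ∅
    disjBC : B ∩ C ≡ ∅
    sizeA  : ∣ A ∣ ≡ k
    sizeB  : ∣ B ∣ ≡ k
    sizeC  : ∣ C ∣ ≡ l
    cover  : A ∪ B ∪ C ≡ Full

{-# OPTIONS --safe #-}
-- Cardinality forces l ≥ k: if l < k then k^l ≤ (k²)^l / l! ≤ e^(k²), contradicting
-- e^(2k²) < k^l. Take any card x, a hand A₁ ∈ 𝒜 containing x and a hand A₂ ∈ 𝒜 avoiding
-- it. Since |A₁ ∪ A₂| ≤ 2k and l ≥ k, some k cards B lie outside A₁ ∪ A₂; then
-- (A₁, B, rest) and (A₂, B, rest) are deals that Bill cannot tell apart, and they differ
-- because A₁ ≠ A₂.
module Submission where

open import Defs
open import Data.Nat using (ℕ; zero; suc; _+_; _*_; _^_; _!; _∸_; _≤_; _≤?_; s≤s; z≤n; NonZero)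
import Data.Nat.Properties as ℕ
open import Data.Integer as ℤ using (+_)
import Data.Integer.Properties as ℤ
open import Data.Rational as ℚ using (0ℚ; _/_)
import Data.Rational.Properties as ℚ
import Data.Rational.Unnormalised as ℚᵘ
import Data.Rational.Unnormalised.Properties as ℚᵘ
open import Data.Fin using (Fin; zero)
open import Data.Fin.Subset
  using (Subset; _∩_; _∪_; ∁; ∣_∣; _∈_; _∉_; _⊆_; inside; outside) renaming (⊥ to ∅)
open import Data.Fin.Subset.Properties
open import Data.Vec using ([]; _∷_)
open import Data.Product using (Σ; _×_; _,_; ∃; proj₁)
open import Data.Empty using (⊥-elim)
open import Relation.Nullary using (yes; no)
open import Relation.Binary.PropositionalEquality
open import Data.Nat.Tactic.RingSolver using (solve-∀)

*≤*⇒/≤/ : ∀ a b c d .{{_ : NonZero b}} .{{_ : NonZero d}} →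
           a * d ≤ c * b → + a / b ℚ.≤ + c / d
*≤*⇒/≤/ a (suc b) c (suc d) ad≤cb = ℚ.toℚᵘ-cancel-≤
  (ℚᵘ.≤-respˡ-≃ (ℚᵘ.≃-sym (ℚ.toℚᵘ-fromℚᵘ (ℚᵘ.mkℚᵘ (+ a) b)))
  (ℚᵘ.≤-respʳ-≃ (ℚᵘ.≃-sym (ℚ.toℚᵘ-fromℚᵘ (ℚᵘ.mkℚᵘ (+ c) d)))
    (ℚᵘ.*≤* (subst₂ ℤ._≤_ (ℤ.pos-* a (suc d)) (ℤ.pos-* c (suc b)) (ℤ.+≤+ ad≤cb)))))

^*!≤^² : ∀ k n → n ≤ k → k ^ n * n ! ≤ (k * k) ^ n
^*!≤^² k zero    _   = ℕ.≤-refl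
^*!≤^² k (suc n) n<k = begin
  k * k ^ n * (suc n * n !)   ≡⟨ regroup k (k ^ n) (suc n) (n !) ⟩
  (k * suc n) * (k ^ n * n !) ≤⟨ ℕ.*-mono-≤ (ℕ.*-monoʳ-≤ k n<k) (^*!≤^² k n (ℕ.<⇒≤ n<k)) ⟩
  k * k * (k * k) ^ n         ∎
  where
  open ℕ.≤-Reasoning
  regroup : ∀ a b c d → a * b * (c * d) ≡ (a * c) * (b * d)
  regroup = solve-∀

0≤expTerm : ∀ m n → 0ℚ ℚ.≤ expTerm m n
0≤expTerm m n = *≤*⇒/≤/ 0 1 (m ^ n) (n !) {{_}} {{n ℕ.!≢0}} z≤n

0≤expPartial : ∀ m N → 0ℚ ℚ.≤ expPartial m N
0≤expPartial m zero    = ℚ.≤-refl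
0≤expPartial m (suc N) = ℚ.+-mono-≤ (0≤expPartial m N) (0≤expTerm m N)

expTerm≤expPartial : ∀ m n → expTerm m n ℚ.≤ expPartial m (suc n)
expTerm≤expPartial m n =
  subst (ℚ._≤ expPartial m (suc n)) (ℚ.+-identityˡ (expTerm m n))
        (ℚ.+-monoˡ-≤ (expTerm m n) (0≤expPartial m n))

ExpBelow⇒expTerm< : ∀ {m x} → ExpBelow m x → ∀ n → expTerm m n ℚ.< + x / 1
ExpBelow⇒expTerm< {m} {x} (ε , 0<ε , partial+ε≤x) n = begin-strict
  expTerm m n                    ≤⟨ expTerm≤expPartial m n ⟩
  expPartial m (suc n)           ≡⟨ ℚ.+-identityʳ _ ⟨
  expPartial m (suc n) ℚ.+ 0ℚ    <⟨ ℚ.+-monoʳ-< (expPartial m (suc n)) 0<ε ⟩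
  expPartial m (suc n) ℚ.+ ε     ≤⟨ partial+ε≤x (suc n) ⟩
  + x / 1                        ∎
  where open ℚ.≤-Reasoning

LogBound⇒k≤l : ∀ k l → LogBound k l → k ≤ l
LogBound⇒k≤l k l bound with k ≤? l
... | yes k≤l = k≤l
... | no  k≰l = ⊥-elim (ℚ.<-irrefl refl (ℚ.<-≤-trans (ExpBelow⇒expTerm< {x = k ^ l} bound l) kˡ≤term))
  where
  kˡ*l!≤[2k²]ˡ : k ^ l * l ! ≤ (2 * (k * k)) ^ l * 1
  kˡ*l!≤[2k²]ˡ = begin
    k ^ l * l !         ≤⟨ ^*!≤^² k l (ℕ.<⇒≤ (ℕ.≰⇒> k≰l)) ⟩
    (k * k) ^ l         ≤⟨ ℕ.^-monoˡ-≤ l (ℕ.m≤n*m (k * k) 2) ⟩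
    (2 * (k * k)) ^ l   ≡⟨ ℕ.*-identityʳ _ ⟨
    (2 * (k * k)) ^ l * 1 ∎
    where open ℕ.≤-Reasoning
  kˡ≤term : + (k ^ l) / 1 ℚ.≤ expTerm (2 * (k * k)) l
  kˡ≤term = *≤*⇒/≤/ (k ^ l) 1 ((2 * (k * k)) ^ l) (l !) {{_}} {{l ℕ.!≢0}} kˡ*l!≤[2k²]ˡ

∣p∪q∣+∣p∩q∣≡∣p∣+∣q∣ : ∀ {n} (p q : Subset n) → ∣ p ∪ q ∣ + ∣ p ∩ q ∣ ≡ ∣ p ∣ + ∣ q ∣
∣p∪q∣+∣p∩q∣≡∣p∣+∣q∣ []            []            = refl
∣p∪q∣+∣p∩q∣≡∣p∣+∣q∣ (inside  ∷ p) (inside  ∷ q) =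
  cong suc (trans (ℕ.+-suc _ _) (trans (cong suc (∣p∪q∣+∣p∩q∣≡∣p∣+∣q∣ p q)) (sym (ℕ.+-suc _ _))))
∣p∪q∣+∣p∩q∣≡∣p∣+∣q∣ (inside  ∷ p) (outside ∷ q) = cong suc (∣p∪q∣+∣p∩q∣≡∣p∣+∣q∣ p q)
∣p∪q∣+∣p∩q∣≡∣p∣+∣q∣ (outside ∷ p) (inside  ∷ q) =
  trans (cong suc (∣p∪q∣+∣p∩q∣≡∣p∣+∣q∣ p q)) (sym (ℕ.+-suc _ _))
∣p∪q∣+∣p∩q∣≡∣p∣+∣q∣ (outside ∷ p) (outside ∷ q) = ∣p∪q∣+∣p∩q∣≡∣p∣+∣q∣ p q

∣p∪q∣≤∣p∣+∣q∣ : ∀ {n} (p q : Subset n) → ∣ p ∪ q ∣ ≤ ∣ p ∣ + ∣ q ∣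
∣p∪q∣≤∣p∣+∣q∣ p q = subst (∣ p ∪ q ∣ ≤_) (∣p∪q∣+∣p∩q∣≡∣p∣+∣q∣ p q) (ℕ.m≤m+n _ _)

p∩q≡∅⇒∣p∪q∣≡∣p∣+∣q∣ : ∀ {n} (p q : Subset n) → p ∩ q ≡ ∅ → ∣ p ∪ q ∣ ≡ ∣ p ∣ + ∣ q ∣
p∩q≡∅⇒∣p∪q∣≡∣p∣+∣q∣ {n} p q p∩q≡∅ = begin
  ∣ p ∪ q ∣               ≡⟨ ℕ.+-identityʳ _ ⟨
  ∣ p ∪ q ∣ + 0           ≡⟨ cong (λ m → ∣ p ∪ q ∣ + m) (∣⊥∣≡0 n) ⟨
  ∣ p ∪ q ∣ + ∣ ∅ {n} ∣   ≡⟨ cong (λ r → ∣ p ∪ q ∣ + ∣ r ∣) p∩q≡∅ ⟨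
  ∣ p ∪ q ∣ + ∣ p ∩ q ∣   ≡⟨ ∣p∪q∣+∣p∩q∣≡∣p∣+∣q∣ p q ⟩
  ∣ p ∣ + ∣ q ∣           ∎
  where open ≡-Reasoning

p⊆q⇒r⊆∁q⇒p∩r≡∅ : ∀ {n} {p q r : Subset n} → p ⊆ q → r ⊆ ∁ q → p ∩ r ≡ ∅
p⊆q⇒r⊆∁q⇒p∩r≡∅ {p = p} {r = r} p⊆q r⊆∁q = Empty-unique λ (x , x∈p∩r) →
  let x∈p , x∈r = x∈p∩q⁻ p r x∈p∩r in x∈∁p⇒x∉p (r⊆∁q x∈r) (p⊆q x∈p)

∃⊆∣∣≡ : ∀ {n} k (p : Subset n) → k ≤ ∣ p ∣ → ∃ λ q → q ⊆ p × ∣ q ∣ ≡ k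
∃⊆∣∣≡ {n} zero p _ = ∅ , ⊥⊆ , ∣⊥∣≡0 n
∃⊆∣∣≡ (suc k) (inside ∷ p) (s≤s k≤∣p∣) with ∃⊆∣∣≡ k p k≤∣p∣
... | q , q⊆p , ∣q∣≡k = inside ∷ q , in⊆in q⊆p , cong suc ∣q∣≡k
∃⊆∣∣≡ (suc k) (outside ∷ p) k<∣p∣ with ∃⊆∣∣≡ (suc k) p k<∣p∣
... | q , q⊆p , ∣q∣≡k = outside ∷ q , s⊆s q⊆p , ∣q∣≡k

IsDeal-∁ : ∀ {k l} {A B : Subset (k + k + l)} →
           ∣ A ∣ ≡ k → ∣ B ∣ ≡ k → A ∩ B ≡ ∅ → IsDeal k l A B (∁ (A ∪ B))
IsDeal-∁ {k} {l} {A} {B} ∣A∣≡k ∣B∣≡k A∩B≡∅ = record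
  { disjAB = A∩B≡∅
  ; disjAC = p⊆q⇒r⊆∁q⇒p∩r≡∅ (p⊆p∪q B) (λ x∈C → x∈C)
  ; disjBC = p⊆q⇒r⊆∁q⇒p∩r≡∅ (q⊆p∪q A B) (λ x∈C → x∈C)
  ; sizeA  = ∣A∣≡k
  ; sizeB  = ∣B∣≡k
  ; sizeC  = begin
      ∣ ∁ (A ∪ B) ∣             ≡⟨ ∣∁p∣≡n∸∣p∣ (A ∪ B) ⟩
      k + k + l ∸ ∣ A ∪ B ∣     ≡⟨ cong (k + k + l ∸_) (p∩q≡∅⇒∣p∪q∣≡∣p∣+∣q∣ A B A∩B≡∅) ⟩
      k + k + l ∸ (∣ A ∣ + ∣ B ∣) ≡⟨ cong₂ (λ a b → k + k + l ∸ (a + b)) ∣A∣≡k ∣B∣≡k ⟩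
      k + k + l ∸ (k + k)       ≡⟨ ℕ.m+n∸m≡n (k + k) l ⟩
      l                         ∎
  ; cover  = trans (sym (∪-assoc A B _)) (p∪∁p≡⊤ (A ∪ B))
  }
  where open ≡-Reasoning

∃-hand-disjoint-from-both : ∀ {k l} (A₁ A₂ : Subset (k + k + l)) → k ≤ l →
  ∣ A₁ ∣ ≡ k → ∣ A₂ ∣ ≡ k → ∃ λ B → ∣ B ∣ ≡ k × A₁ ∩ B ≡ ∅ × A₂ ∩ B ≡ ∅
∃-hand-disjoint-from-both {k} {l} A₁ A₂ k≤l ∣A₁∣≡k ∣A₂∣≡k
  with ∃⊆∣∣≡ k (∁ (A₁ ∪ A₂)) k≤∣free∣
  where
  k≤∣free∣ : k ≤ ∣ ∁ (A₁ ∪ A₂) ∣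
  k≤∣free∣ = begin
    k                               ≤⟨ k≤l ⟩
    l                               ≡⟨ ℕ.m+n∸m≡n (k + k) l ⟨
    k + k + l ∸ (k + k)             ≡⟨ cong₂ (λ a b → k + k + l ∸ (a + b)) ∣A₁∣≡k ∣A₂∣≡k ⟨
    k + k + l ∸ (∣ A₁ ∣ + ∣ A₂ ∣)   ≤⟨ ℕ.∸-monoʳ-≤ (k + k + l) (∣p∪q∣≤∣p∣+∣q∣ A₁ A₂) ⟩
    k + k + l ∸ ∣ A₁ ∪ A₂ ∣         ≡⟨ ∣∁p∣≡n∸∣p∣ (A₁ ∪ A₂) ⟨
    ∣ ∁ (A₁ ∪ A₂) ∣                 ∎
    where open ℕ.≤-Reasoning
... | B , B⊆free , ∣B∣≡k =
  B , ∣B∣≡k , p⊆q⇒r⊆∁q⇒p∩r≡∅ (p⊆p∪q A₂) B⊆free , p⊆q⇒r⊆∁q⇒p∩r≡∅ (q⊆p∪q A₁ A₂) B⊆free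

lemma4 : (k l : ℕ) → 2 ≤ k → LogBound k l →
           (𝒜 : Subset (k + k + l) → Set) →
           (∃ λ A → 𝒜 A) →
           (∀ A → 𝒜 A → ∣ A ∣ ≡ k) →
           (∀ (x : Fin (k + k + l)) → ∃ λ A → 𝒜 A × x ∈ A) →
           (∀ (x : Fin (k + k + l)) → ∃ λ A → 𝒜 A × x ∉ A) →
           Σ (Subset (k + k + l)) λ A₁ → Σ (Subset (k + k + l)) λ B₁ → Σ (Subset (k + k + l)) λ C₁ →
           Σ (Subset (k + k + l)) λ A₂ → Σ (Subset (k + k + l)) λ B₂ → Σ (Subset (k + k + l)) λ C₂ →
             IsDeal k l A₁ B₁ C₁ × IsDeal k l A₂ B₂ C₂ ×
             𝒜 A₁ × 𝒜 A₂ × B₁ ≡ B₂ × (A₁ , B₁ , C₁) ≢ (A₂ , B₂ , C₂)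
lemma4 zero l ()
lemma4 k@(suc _) l _ bound 𝒜 _ size cover avoid with cover zero | avoid zero
... | A₁ , A₁∈𝒜 , 0∈A₁ | A₂ , A₂∈𝒜 , 0∉A₂
  with ∃-hand-disjoint-from-both A₁ A₂ (LogBound⇒k≤l k l bound) (size A₁ A₁∈𝒜) (size A₂ A₂∈𝒜)
... | B , ∣B∣≡k , A₁∩B≡∅ , A₂∩B≡∅ =
  A₁ , B , ∁ (A₁ ∪ B) , A₂ , B , ∁ (A₂ ∪ B) ,
  IsDeal-∁ (size A₁ A₁∈𝒜) ∣B∣≡k A₁∩B≡∅ , IsDeal-∁ (size A₂ A₂∈𝒜) ∣B∣≡k A₂∩B≡∅ ,
  A₁∈𝒜 , A₂∈𝒜 , refl ,
  λ s₁≡s₂ → 0∉A₂ (subst (zero ∈_) (cong proj₁ s₁≡s₂) 0∈A₁)
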